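{- Let $t\ge 1$ be an integer, let $\Omega\subseteq\mathbb{Q}^r$, and let $A=\{\mathbf{a}_1,\ldots,\mathbf{a}_n\}$, $B=\{\mathbf{b}_1,\ldots,\mathbf{b}_n\}$ be multisets of points of $\Omega$ such that $(A,B)$ is a proper $\mathrm{PTE}_r$ solution of degree $2t$ and size $n$. Let $\mathbf{t}_1,\ldots,\mathbf{t}_d$ be a basis of $\mathcal{P}_t(\Omega)$, where $d=\dim_{\mathbb{Q}}\mathcal{P}_t(\Omega)$, and define the $d\times n$ matrices $N_A=(\mathbf{t}_i(\mathbf{a}_j))_{i,j}$ and $N_B=(\mathbf{t}_i(\mathbf{b}_j))_{i,j}$. Suppose that the $d\times 2n$ matrix $[N_A\;N_B]$ has rank $d$. Then $n\ge \dim_{\mathbb{Q}}\mathcal{P}_t(\Omega)$.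
   Context: For multisets $A=\{\mathbf{a}_1,\ldots,\mathbf{a}_n\}$, $B=\{\mathbf{b}_1,\ldots,\mathbf{b}_n\}$ of vectors in $\mathbb{Q}^r$, with $\mathbf{a}_i=(a_{i1},\ldots,a_{ir})$, $\mathbf{b}_i=(b_{i1},\ldots,b_{ir})$, one writes $[A]=^n_m[B]$ and calls $(A,B)$ a solution of the $r$-dimensional Prouhet–Tarry–Escott problem $\mathrm{PTE}_r$ of degree $m$ and size $n$ if $A$ and $B$ have no element in common and $\sum_{i=1}^n\prod_{j=1}^r a_{ij}^{k_j}=\sum_{i=1}^n\prod_{j=1}^r b_{ij}^{k_j}$ for all nonnegative integers $k_1,\ldots,k_r$ with $1\le k_1+\cdots+k_r\le m$. Such a solution is called (combinatorially) proper if, regarding $A$ and $B$ as $n\times r$ matrices whose rows are the $\mathbf{a}_i$ resp. $\mathbf{b}_i$, $\operatorname{rank}A=\operatorname{rank}B=r$. For $\Omega\subseteq\mathbb{Q}^r$, $\mathcal{P}_t(\Omega)$ denotes the $\mathbb{Q}$-vector space of functions on $\Omega$ that are restrictions of polynomials in $r$ variables with rational coefficients of degree at most $t$. -}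

module Defs where

open import Data.Nat as ℕ using (ℕ; zero; suc)
open import Data.Fin using (Fin; zero; suc)
open import Data.Rational using (ℚ; 0ℚ; 1ℚ; _+_; _*_)
open import Data.List using (List; []; _∷_)
open import Data.List.Relation.Unary.All using (All)
open import Data.Product using (_×_; _,_; proj₁; proj₂)
open import Relation.Binary.PropositionalEquality using (_≡_)
open import Relation.Nullary using (¬_)

Pt : ℕ → Set
Pt r = Fin r → ℚ

Σℚ : ∀ {n} → (Fin n → ℚ) → ℚ
Σℚ {zero}  f = 0ℚ
Σℚ {suc n} f = f zero + Σℚ (λ i → f (suc i))

Πℚ : ∀ {n} → (Fin n → ℚ) → ℚ
Πℚ {zero}  f = 1ℚ
Πℚ {suc n} f = f zero * Πℚ (λ i → f (suc i))

Σℕ : ∀ {n} → (Fin n → ℕ) → ℕ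
Σℕ {zero}  f = 0
Σℕ {suc n} f = f zero ℕ.+ Σℕ (λ i → f (suc i))

_^ℚ_ : ℚ → ℕ → ℚ
x ^ℚ zero  = 1ℚ
x ^ℚ suc k = x * (x ^ℚ k)

monomial : ∀ {r} → (Fin r → ℕ) → Pt r → ℚ
monomial k x = Πℚ (λ j → x j ^ℚ k j)

totalDeg : ∀ {r} → (Fin r → ℕ) → ℕ
totalDeg k = Σℕ k

-- (A , B) is a solution of PTE_r of degree m and size n (A, B multisets given as
-- n-indexed families of points).
IsPTE : ∀ {r} (m n : ℕ) → (Fin n → Pt r) → (Fin n → Pt r) → Set
IsPTE {r} m n A B =
  (∀ (i j : Fin n) → ¬ (A i ≡ B j)) ×
  (∀ (k : Fin r → ℕ) → 1 ℕ.≤ totalDeg k → totalDeg k ℕ.≤ m →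
     Σℚ (λ i → monomial k (A i)) ≡ Σℚ (λ i → monomial k (B i)))

-- Rank of the n×r matrix with rows M i equals r  (columns linearly independent).
FullColumnRank : ∀ {n r} → (Fin n → Pt r) → Set
FullColumnRank {n} {r} M =
  ∀ (c : Fin r → ℚ) → (∀ i → Σℚ (λ j → c j * M i j) ≡ 0ℚ) → ∀ j → c j ≡ 0ℚ

IsProperPTE : ∀ {r} (m n : ℕ) → (Fin n → Pt r) → (Fin n → Pt r) → Set
IsProperPTE m n A B = IsPTE m n A B × FullColumnRank A × FullColumnRank B

record Poly (r t : ℕ) : Set where
  constructor mkPoly
  field
    terms   : List (ℚ × (Fin r → ℕ))
    degree≤ : All (λ m → totalDeg (proj₂ m) ℕ.≤ t) terms

evalTerms : ∀ {r} → List (ℚ × (Fin r → ℕ)) → Pt r → ℚ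
evalTerms []            x = 0ℚ
evalTerms ((c , k) ∷ ps) x = c * monomial k x + evalTerms ps x

eval : ∀ {r t} → Poly r t → Pt r → ℚ
eval p = evalTerms (Poly.terms p)

-- P_t(Ω) is the space of functions Ω → ℚ that are
-- restrictions of polynomials in Poly r t; two functions are equal iff they agree on Ω.
-- A basis of P_t(Ω) of size d, given by polynomials whose restrictions to Ω are the basis:
IsBasisPt : ∀ {r} (t : ℕ) (Ω : Pt r → Set) (d : ℕ) → (Fin d → Poly r t) → Set
IsBasisPt {r} t Ω d T =
  (∀ (c : Fin d → ℚ) →
     (∀ x → Ω x → Σℚ (λ i → c i * eval (T i) x) ≡ 0ℚ) → ∀ i → c i ≡ 0ℚ) ×
  (∀ (q : Poly r t) → Σ-span q)
  where
  open import Data.Product using (∃)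
  Σ-span : Poly r t → Set
  Σ-span q = ∃ λ (c : Fin d → ℚ) → ∀ x → Ω x → eval q x ≡ Σℚ (λ i → c i * eval (T i) x)

-- The d×2n matrix [N_A N_B], N_A = (t_i(a_j)), has rank d (its d rows are linearly
-- independent).
RowsIndependent2 : ∀ {r t d n} → (Fin d → Poly r t) → (Fin n → Pt r) → (Fin n → Pt r) → Set
RowsIndependent2 {d = d} T A B =
  ∀ (c : Fin d → ℚ) →
    (∀ j → Σℚ (λ i → c i * eval (T i) (A j)) ≡ 0ℚ) →
    (∀ j → Σℚ (λ i → c i * eval (T i) (B j)) ≡ 0ℚ) →
    ∀ i → c i ≡ 0ℚ

-- If d > n, the n equations Σᵢ cᵢ tᵢ(aⱼ) = 0 in d unknowns have a solution c ≠ 0.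
-- Then F = Σᵢ cᵢ tᵢ is a polynomial of degree ≤ t vanishing on A, and F² has degree
-- ≤ 2t, so the PTE identities (together with |A| = |B| for the constant term) give
-- Σⱼ F(bⱼ)² = Σⱼ F(aⱼ)² = 0.  Hence F also vanishes on B, i.e. c is a nonzero vector
-- in the left kernel of [N_A N_B], contradicting rank [N_A N_B] = d.

module Submission where

open import Defs
open import Data.Nat using (ℕ; _≤_; _*_)
open import Data.Fin using (Fin)

open import Algebra.Bundles using (CommutativeMonoid; CommutativeRing)
import Algebra.Properties.CommutativeSemigroup as CommutativeSemigroupProperties
open import Data.Fin using (zero; suc; punchIn; punchOut; _≟_)
open import Data.Fin.Properties using (all?; ¬∀⟶∃¬; punchIn-punchOut)
open import Data.List using (List; []; _∷_; _++_; map)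
open import Data.List.Relation.Unary.All as All using (All; []; _∷_)
open import Data.List.Relation.Unary.All.Properties using (map⁺; ++⁺)
open import Data.Nat as ℕ using (zero; suc; _<_; s≤s; _≤?_)
open import Data.Nat.Properties
  using ( ≤-trans; ≤-reflexive; +-mono-≤; ≰⇒>; n<1⇒n≡0; m+n≡0⇒m≡0; m+n≡0⇒n≡0; +-identityʳ
        ; +-commutativeSemigroup)
open import Data.Product using (∃-syntax; _×_; _,_; proj₂; map₁)
open import Data.Rational as ℚ using (ℚ; 0ℚ; 1ℚ; _+_; -_; 1/_) renaming (_*_ to _·_)
import Data.Rational.Properties as ℚ
open import Data.Rational.Solver using (module +-*-Solver)
open import Data.Sum using (inj₁; inj₂)
open import Data.Vec.Functional using (tail; zipWith)
open import Function using (_∘_)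
open import Relation.Binary.PropositionalEquality
  using (_≡_; _≢_; refl; sym; trans; cong; cong₂; subst; ≢-sym; module ≡-Reasoning)
open import Relation.Nullary using (¬_; yes; no; contradiction)

open import Algebra.Properties.Semiring.Sum (CommutativeRing.semiring ℚ.+-*-commutativeRing)
  using (sum; sum-cong-≗; ∑-distrib-+; *-distribˡ-sum; sum-replicate-zero)
open CommutativeSemigroupProperties (CommutativeMonoid.commutativeSemigroup ℚ.*-1-commutativeMonoid)
  using () renaming (interchange to ·-interchange)
open CommutativeSemigroupProperties +-commutativeSemigroup
  using () renaming (interchange to +-interchange)
open +-*-Solver using (solve; _:+_; _:*_; :-_; _:=_; con)
open ≡-Reasoning

-- Finite sums of rationals

Σℚ≡sum : ∀ {n} (f : Fin n → ℚ) → Σℚ f ≡ sum f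
Σℚ≡sum {zero}  f = refl
Σℚ≡sum {suc n} f = cong (f zero +_) (Σℚ≡sum (tail f))

sum-zero : ∀ {n} (f : Fin n → ℚ) → (∀ i → f i ≡ 0ℚ) → sum f ≡ 0ℚ
sum-zero {n} f f≡0 = trans (sum-cong-≗ f≡0) (sum-replicate-zero n)

p·q≡0⇒q≡0 : ∀ {p q} → p ≢ 0ℚ → p · q ≡ 0ℚ → q ≡ 0ℚ
p·q≡0⇒q≡0 {p} {q} p≢0 p·q≡0 = begin
  q              ≡⟨ ℚ.*-identityˡ q ⟨
  1ℚ · q         ≡⟨ cong (_· q) (ℚ.*-inverseˡ p) ⟨
  (1/ p · p) · q ≡⟨ ℚ.*-assoc (1/ p) p q ⟩
  1/ p · (p · q) ≡⟨ cong (1/ p ·_) p·q≡0 ⟩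
  1/ p · 0ℚ      ≡⟨ ℚ.*-zeroʳ (1/ p) ⟩
  0ℚ             ∎
  where
  instance
    p-nonZero : ℚ.NonZero p
    p-nonZero = ℚ.≢-nonZero p≢0

p·p≡0⇒p≡0 : ∀ {p} → p · p ≡ 0ℚ → p ≡ 0ℚ
p·p≡0⇒p≡0 {p} p·p≡0 with p ℚ.≟ 0ℚ
... | yes p≡0 = p≡0
... | no  p≢0 = p·q≡0⇒q≡0 p≢0 p·p≡0

square-nonNeg : ∀ p → 0ℚ ℚ.≤ p · p
square-nonNeg p with ℚ.≤-total 0ℚ p
... | inj₁ 0≤p = ℚ.nonNegative⁻¹ (p · p)
  {{ℚ.nonNeg*nonNeg⇒nonNeg p {{ℚ.nonNegative 0≤p}} p {{ℚ.nonNegative 0≤p}}}}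
-- Despite its name, nonPos*nonPos⇒nonPos concludes NonNegative.
... | inj₂ p≤0 = ℚ.nonNegative⁻¹ (p · p)
  {{ℚ.nonPos*nonPos⇒nonPos p {{ℚ.nonPositive p≤0}} p {{ℚ.nonPositive p≤0}}}}

nonNeg+nonNeg≡0⇒≡0 : ∀ {p q} → 0ℚ ℚ.≤ p → 0ℚ ℚ.≤ q → p + q ≡ 0ℚ → p ≡ 0ℚ × q ≡ 0ℚ
nonNeg+nonNeg≡0⇒≡0 {p} {q} 0≤p 0≤q p+q≡0 = p≡0 , q≡0
  where
  p≤0 : p ℚ.≤ 0ℚ
  p≤0 = ℚ.≤-trans (ℚ.≤-reflexive (sym (ℚ.+-identityʳ p)))
                  (ℚ.≤-trans (ℚ.+-monoʳ-≤ p 0≤q) (ℚ.≤-reflexive p+q≡0))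
  p≡0 : p ≡ 0ℚ
  p≡0 = ℚ.≤-antisym p≤0 0≤p
  q≡0 : q ≡ 0ℚ
  q≡0 = trans (sym (ℚ.+-identityˡ q)) (trans (cong (_+ q) (sym p≡0)) p+q≡0)

sum-nonNeg : ∀ {n} (f : Fin n → ℚ) → (∀ i → 0ℚ ℚ.≤ f i) → 0ℚ ℚ.≤ sum f
sum-nonNeg {zero}  f 0≤f = ℚ.≤-refl
sum-nonNeg {suc n} f 0≤f =
  ℚ.≤-trans (ℚ.≤-reflexive (sym (ℚ.+-identityʳ 0ℚ)))
            (ℚ.+-mono-≤ (0≤f zero) (sum-nonNeg (tail f) (0≤f ∘ suc)))

sum-nonNeg≡0⇒≡0 : ∀ {n} (f : Fin n → ℚ) → (∀ i → 0ℚ ℚ.≤ f i) → sum f ≡ 0ℚ →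
                  ∀ i → f i ≡ 0ℚ
sum-nonNeg≡0⇒≡0 {suc n} f 0≤f Σf≡0 i
  with nonNeg+nonNeg≡0⇒≡0 (0≤f zero) (sum-nonNeg (tail f) (0≤f ∘ suc)) Σf≡0
sum-nonNeg≡0⇒≡0 f 0≤f Σf≡0 zero    | f₀≡0 , _      = f₀≡0
sum-nonNeg≡0⇒≡0 f 0≤f Σf≡0 (suc i) | _    , rest≡0 = sum-nonNeg≡0⇒≡0 (tail f) (0≤f ∘ suc) rest≡0 i

sum-squares≡0⇒≡0 : ∀ {n} (f : Fin n → ℚ) → sum (λ i → f i · f i) ≡ 0ℚ → ∀ i → f i ≡ 0ℚ
sum-squares≡0⇒≡0 f Σf²≡0 i =
  p·p≡0⇒p≡0 (sum-nonNeg≡0⇒≡0 (λ i → f i · f i) (square-nonNeg ∘ f) Σf²≡0 i)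

-- Homogeneous linear systems

dot : ∀ {d} → (Fin d → ℚ) → (Fin d → ℚ) → ℚ
dot c v = sum (λ i → c i · v i)

dot-scaleˡ : ∀ {d} a (c v : Fin d → ℚ) → dot (λ i → a · c i) v ≡ a · dot c v
dot-scaleˡ a c v = begin
  sum (λ i → (a · c i) · v i) ≡⟨ sum-cong-≗ (λ i → ℚ.*-assoc a (c i) (v i)) ⟩
  sum (λ i → a · (c i · v i)) ≡⟨ *-distribˡ-sum a (λ i → c i · v i) ⟨
  a · dot c v                 ∎

dot-linearʳ : ∀ {d} (c u v : Fin d → ℚ) a b →
              dot c (λ i → a · u i + b · v i) ≡ a · dot c u + b · dot c v
dot-linearʳ c u v a b = begin
  sum (λ i → c i · (a · u i + b · v i))
    ≡⟨ sum-cong-≗ (λ i → regroup (c i) (u i) (v i)) ⟩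
  sum (λ i → a · (c i · u i) + b · (c i · v i))
    ≡⟨ ∑-distrib-+ (λ i → a · (c i · u i)) (λ i → b · (c i · v i)) ⟩
  sum (λ i → a · (c i · u i)) + sum (λ i → b · (c i · v i))
    ≡⟨ cong₂ _+_ (*-distribˡ-sum a (λ i → c i · u i)) (*-distribˡ-sum b (λ i → c i · v i)) ⟨
  a · dot c u + b · dot c v ∎
  where
  regroup : ∀ x y z → x · (a · y + b · z) ≡ a · (x · y) + b · (x · z)
  regroup = solve 5 (λ a b x y z → x :* (a :* y :+ b :* z) := a :* (x :* y) :+ b :* (x :* z))
                  refl a b

NonTrivial : ∀ {d} → (Fin d → ℚ) → Set
NonTrivial c = ¬ (∀ i → c i ≡ 0ℚ)

NonTrivialSolution : ∀ {n d} → (Fin n → Fin d → ℚ) → Set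
NonTrivialSolution M = ∃[ c ] NonTrivial c × (∀ j → dot c (M j) ≡ 0ℚ)

e₀ : ∀ {d} → Fin (suc d) → ℚ
e₀ zero    = 1ℚ
e₀ (suc _) = 0ℚ

dot-e₀ : ∀ {d} (v : Fin (suc d) → ℚ) → dot e₀ v ≡ v zero
dot-e₀ v = begin
  1ℚ · v zero + sum (λ i → 0ℚ · v (suc i))
    ≡⟨ cong₂ _+_ (ℚ.*-identityˡ (v zero)) (sum-zero _ (ℚ.*-zeroˡ ∘ tail v)) ⟩
  v zero + 0ℚ
    ≡⟨ ℚ.+-identityʳ (v zero) ⟩
  v zero ∎

-- Gaussian elimination of the first unknown, with row j₀ as pivot row.
module _ {m d} (M : Fin m → Fin (suc d) → ℚ) (j₀ : Fin m) where

  eliminate : Fin m → Fin d → ℚ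
  eliminate j i = M j₀ zero · M j (suc i) + (- M j zero) · M j₀ (suc i)

  backSubstitute : (Fin d → ℚ) → Fin (suc d) → ℚ
  backSubstitute c zero    = - dot c (tail (M j₀))
  backSubstitute c (suc i) = M j₀ zero · c i

  dot-backSubstitute : ∀ c j → dot (backSubstitute c) (M j) ≡ dot c (eliminate j)
  dot-backSubstitute c j = begin
    - s · M j zero + dot (λ i → p · c i) (tail (M j))
      ≡⟨ cong (- s · M j zero +_) (dot-scaleˡ p c (tail (M j))) ⟩
    - s · M j zero + p · dot c (tail (M j))
      ≡⟨ solve 4 (λ s m p x → :- s :* m :+ p :* x := p :* x :+ (:- m) :* s) refl
           s (M j zero) p (dot c (tail (M j))) ⟩
    p · dot c (tail (M j)) + (- M j zero) · s
      ≡⟨ dot-linearʳ c (tail (M j)) (tail (M j₀)) p (- M j zero) ⟨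
    dot c (eliminate j) ∎
    where
    p s : ℚ
    p = M j₀ zero
    s = dot c (tail (M j₀))

  dot-eliminate-pivot : ∀ c → dot c (eliminate j₀) ≡ 0ℚ
  dot-eliminate-pivot c = begin
    dot c (eliminate j₀)      ≡⟨ dot-linearʳ c (tail (M j₀)) (tail (M j₀)) p (- p) ⟩
    p · s + (- p) · s         ≡⟨ solve 2 (λ p s → p :* s :+ (:- p) :* s := con 0ℚ) refl p s ⟩
    0ℚ                        ∎
    where
    p s : ℚ
    p = M j₀ zero
    s = dot c (tail (M j₀))

  backSubstitute-nonTrivial : M j₀ zero ≢ 0ℚ → ∀ {c} → NonTrivial c →
                              NonTrivial (backSubstitute c)
  backSubstitute-nonTrivial p≢0 c≢0 c′≡0 = c≢0 (λ i → p·q≡0⇒q≡0 p≢0 (c′≡0 (suc i)))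

n<d⇒nonTrivialSolution : ∀ {n d} → n < d → (M : Fin n → Fin d → ℚ) → NonTrivialSolution M
pivot⇒nonTrivialSolution : ∀ {n d} → n ≤ d → (M : Fin n → Fin (suc d) → ℚ) (j₀ : Fin n) →
                           M j₀ zero ≢ 0ℚ → NonTrivialSolution M

n<d⇒nonTrivialSolution {n} {suc d} (s≤s n≤d) M with all? (λ j → M j zero ℚ.≟ 0ℚ)
... | yes column₀≡0 =
  e₀ , (λ e₀≡0 → ℚ.1≢0 (e₀≡0 zero)) , (λ j → trans (dot-e₀ (M j)) (column₀≡0 j))
... | no  column₀≢0 with ¬∀⟶∃¬ n _ (λ j → M j zero ℚ.≟ 0ℚ) column₀≢0
...   | j₀ , pivot≢0 = pivot⇒nonTrivialSolution n≤d M j₀ pivot≢0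

pivot⇒nonTrivialSolution {zero}  _  M () _
pivot⇒nonTrivialSolution {suc n} {suc d} (s≤s n≤d) M j₀ p≢0
  with n<d⇒nonTrivialSolution (s≤s n≤d) (eliminate M j₀ ∘ punchIn j₀)
... | c , c≢0 , c⊥ =
  backSubstitute M j₀ c , backSubstitute-nonTrivial M j₀ p≢0 c≢0 ,
  (λ j → trans (dot-backSubstitute M j₀ c j) (eliminated-rows-vanish j))
  where
  eliminated-rows-vanish : ∀ j → dot c (eliminate M j₀ j) ≡ 0ℚ
  eliminated-rows-vanish j with j ≟ j₀
  ... | yes refl = dot-eliminate-pivot M j₀ c
  ... | no  j≢j₀ = begin
    dot c (eliminate M j₀ j)
      ≡⟨ cong (dot c ∘ eliminate M j₀) (punchIn-punchOut (≢-sym j≢j₀)) ⟨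
    dot c (eliminate M j₀ (punchIn j₀ (punchOut (≢-sym j≢j₀))))
      ≡⟨ c⊥ (punchOut (≢-sym j≢j₀)) ⟩
    0ℚ ∎

-- Polynomial arithmetic

^ℚ-+ : ∀ x a b → x ^ℚ (a ℕ.+ b) ≡ x ^ℚ a · x ^ℚ b
^ℚ-+ x zero    b = sym (ℚ.*-identityˡ (x ^ℚ b))
^ℚ-+ x (suc a) b = trans (cong (x ·_) (^ℚ-+ x a b)) (sym (ℚ.*-assoc x (x ^ℚ a) (x ^ℚ b)))

monomial-+ : ∀ {r} (k l : Fin r → ℕ) x →
             monomial (zipWith ℕ._+_ k l) x ≡ monomial k x · monomial l x
monomial-+ {zero}  k l x = sym (ℚ.*-identityˡ 1ℚ)
monomial-+ {suc r} k l x = begin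
  x₀ ^ℚ (k zero ℕ.+ l zero) · monomial (zipWith ℕ._+_ k′ l′) x′
    ≡⟨ cong₂ _·_ (^ℚ-+ x₀ (k zero) (l zero)) (monomial-+ k′ l′ x′) ⟩
  (x₀ ^ℚ k zero · x₀ ^ℚ l zero) · (monomial k′ x′ · monomial l′ x′)
    ≡⟨ ·-interchange (x₀ ^ℚ k zero) (x₀ ^ℚ l zero) (monomial k′ x′) (monomial l′ x′) ⟩
  (x₀ ^ℚ k zero · monomial k′ x′) · (x₀ ^ℚ l zero · monomial l′ x′) ∎
  where
  x₀ : ℚ
  x₀ = x zero
  x′ : Pt r
  x′ = tail x
  k′ l′ : Fin r → ℕ
  k′ = tail k
  l′ = tail l

totalDeg-+ : ∀ {r} (k l : Fin r → ℕ) → totalDeg (zipWith ℕ._+_ k l) ≡ totalDeg k ℕ.+ totalDeg l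
totalDeg-+ {zero}  k l = refl
totalDeg-+ {suc r} k l =
  trans (cong (k zero ℕ.+ l zero ℕ.+_) (totalDeg-+ (tail k) (tail l)))
        (+-interchange (k zero) (l zero) (totalDeg (tail k)) (totalDeg (tail l)))

monomial-degree0 : ∀ {r} (k : Fin r → ℕ) → totalDeg k ≡ 0 → ∀ x → monomial k x ≡ 1ℚ
monomial-degree0 {zero}  k _     x = refl
monomial-degree0 {suc r} k |k|≡0 x =
  trans (cong₂ _·_ (cong (x zero ^ℚ_) (m+n≡0⇒m≡0 (k zero) |k|≡0))
                   (monomial-degree0 (tail k) (m+n≡0⇒n≡0 (k zero) |k|≡0) (tail x)))
        (ℚ.*-identityˡ 1ℚ)

Terms : ℕ → Set
Terms r = List (ℚ × (Fin r → ℕ))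

DegreeAtMost : ∀ {r} → ℕ → Terms r → Set
DegreeAtMost t = All (λ m → totalDeg (proj₂ m) ≤ t)

evalTerms-++ : ∀ {r} (ps qs : Terms r) x →
               evalTerms (ps ++ qs) x ≡ evalTerms ps x + evalTerms qs x
evalTerms-++ []             qs x = sym (ℚ.+-identityˡ (evalTerms qs x))
evalTerms-++ ((a , k) ∷ ps) qs x =
  trans (cong (a · monomial k x +_) (evalTerms-++ ps qs x))
        (sym (ℚ.+-assoc (a · monomial k x) (evalTerms ps x) (evalTerms qs x)))

evalTerms-scale : ∀ {r} a (ps : Terms r) x →
                  evalTerms (map (map₁ (a ·_)) ps) x ≡ a · evalTerms ps x
evalTerms-scale a []             x = sym (ℚ.*-zeroʳ a)
evalTerms-scale a ((b , k) ∷ ps) x =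
  trans (cong₂ _+_ (ℚ.*-assoc a b (monomial k x)) (evalTerms-scale a ps x))
        (sym (ℚ.*-distribˡ-+ a (b · monomial k x) (evalTerms ps x)))

mulTerm : ∀ {r} → ℚ × (Fin r → ℕ) → ℚ × (Fin r → ℕ) → ℚ × (Fin r → ℕ)
mulTerm (a , k) (b , l) = a · b , zipWith ℕ._+_ k l

infixl 7 _*ᵀ_

_*ᵀ_ : ∀ {r} → Terms r → Terms r → Terms r
[]       *ᵀ qs = []
(m ∷ ps) *ᵀ qs = map (mulTerm m) qs ++ ps *ᵀ qs

evalTerms-mulTerm : ∀ {r} a (k : Fin r → ℕ) (qs : Terms r) x →
                    evalTerms (map (mulTerm (a , k)) qs) x ≡ (a · monomial k x) · evalTerms qs x
evalTerms-mulTerm a k []             x = sym (ℚ.*-zeroʳ (a · monomial k x))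
evalTerms-mulTerm a k ((b , l) ∷ qs) x = begin
  (a · b) · monomial (zipWith ℕ._+_ k l) x + evalTerms (map (mulTerm (a , k)) qs) x
    ≡⟨ cong₂ (λ m e → (a · b) · m + e) (monomial-+ k l x) (evalTerms-mulTerm a k qs x) ⟩
  (a · b) · (monomial k x · monomial l x) + (a · monomial k x) · evalTerms qs x
    ≡⟨ solve 5 (λ a b m n e → (a :* b) :* (m :* n) :+ (a :* m) :* e
                              := (a :* m) :* (b :* n :+ e))
             refl a b (monomial k x) (monomial l x) (evalTerms qs x) ⟩
  (a · monomial k x) · (b · monomial l x + evalTerms qs x) ∎

evalTerms-*ᵀ : ∀ {r} (ps qs : Terms r) x →
               evalTerms (ps *ᵀ qs) x ≡ evalTerms ps x · evalTerms qs x
evalTerms-*ᵀ []             qs x = sym (ℚ.*-zeroˡ (evalTerms qs x))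
evalTerms-*ᵀ ((a , k) ∷ ps) qs x = begin
  evalTerms (map (mulTerm (a , k)) qs ++ ps *ᵀ qs) x
    ≡⟨ evalTerms-++ (map (mulTerm (a , k)) qs) (ps *ᵀ qs) x ⟩
  evalTerms (map (mulTerm (a , k)) qs) x + evalTerms (ps *ᵀ qs) x
    ≡⟨ cong₂ _+_ (evalTerms-mulTerm a k qs x) (evalTerms-*ᵀ ps qs x) ⟩
  (a · monomial k x) · evalTerms qs x + evalTerms ps x · evalTerms qs x
    ≡⟨ ℚ.*-distribʳ-+ (evalTerms qs x) (a · monomial k x) (evalTerms ps x) ⟨
  (a · monomial k x + evalTerms ps x) · evalTerms qs x ∎

mulTerm-degree : ∀ {r s t} (m m′ : ℚ × (Fin r → ℕ)) →
                 totalDeg (proj₂ m) ≤ s → totalDeg (proj₂ m′) ≤ t →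
                 totalDeg (proj₂ (mulTerm m m′)) ≤ s ℕ.+ t
mulTerm-degree (a , k) (b , l) |k|≤s |l|≤t =
  subst (_≤ _) (sym (totalDeg-+ k l)) (+-mono-≤ |k|≤s |l|≤t)

*ᵀ-degree : ∀ {r s t} {ps qs : Terms r} →
            DegreeAtMost s ps → DegreeAtMost t qs → DegreeAtMost (s ℕ.+ t) (ps *ᵀ qs)
*ᵀ-degree {ps = []}     []             qs≤t = []
*ᵀ-degree {ps = m ∷ ps} (|m|≤s ∷ ps≤s) qs≤t =
  ++⁺ (map⁺ (All.map (λ {m′} → mulTerm-degree m m′ |m|≤s) qs≤t)) (*ᵀ-degree ps≤s qs≤t)

module _ {r t : ℕ} where

  infixl 6 _+ᴾ_
  infixr 7 _·ᴾ_

  0ᴾ : Poly r t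
  0ᴾ = mkPoly [] []

  _+ᴾ_ : Poly r t → Poly r t → Poly r t
  mkPoly ps ps≤t +ᴾ mkPoly qs qs≤t = mkPoly (ps ++ qs) (++⁺ ps≤t qs≤t)

  _·ᴾ_ : ℚ → Poly r t → Poly r t
  a ·ᴾ mkPoly ps ps≤t = mkPoly (map (map₁ (a ·_)) ps) (map⁺ ps≤t)

  lincomb : ∀ {d} → (Fin d → ℚ) → (Fin d → Poly r t) → Poly r t
  lincomb {zero}  c T = 0ᴾ
  lincomb {suc d} c T = c zero ·ᴾ T zero +ᴾ lincomb (tail c) (tail T)

  eval-lincomb : ∀ {d} (c : Fin d → ℚ) (T : Fin d → Poly r t) x →
                 eval (lincomb c T) x ≡ sum (λ i → c i · eval (T i) x)
  eval-lincomb {zero}  c T x = refl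
  eval-lincomb {suc d} c T x = begin
    evalTerms (Poly.terms (c zero ·ᴾ T zero) ++ Poly.terms rest) x
      ≡⟨ evalTerms-++ (Poly.terms (c zero ·ᴾ T zero)) (Poly.terms rest) x ⟩
    eval (c zero ·ᴾ T zero) x + eval rest x
      ≡⟨ cong₂ _+_ (evalTerms-scale (c zero) (Poly.terms (T zero)) x)
                   (eval-lincomb (tail c) (tail T) x) ⟩
    c zero · eval (T zero) x + sum (λ i → c (suc i) · eval (T (suc i)) x) ∎
    where
    rest : Poly r t
    rest = lincomb (tail c) (tail T)

  weaken : ∀ {s} → s ≤ t → Poly r s → Poly r t
  weaken s≤t p = mkPoly (Poly.terms p) (All.map (λ k≤s → ≤-trans k≤s s≤t) (Poly.degree≤ p))

infixl 7 _*ᴾ_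

_*ᴾ_ : ∀ {r s t} → Poly r s → Poly r t → Poly r (s ℕ.+ t)
p *ᴾ q = mkPoly (Poly.terms p *ᵀ Poly.terms q) (*ᵀ-degree (Poly.degree≤ p) (Poly.degree≤ q))

eval-*ᴾ : ∀ {r s t} (p : Poly r s) (q : Poly r t) x → eval (p *ᴾ q) x ≡ eval p x · eval q x
eval-*ᴾ p q = evalTerms-*ᵀ (Poly.terms p) (Poly.terms q)

-- Power sums of PTE solutions

module _ {r n : ℕ} (A B : Fin n → Pt r) where

  SumsAgree : (Pt r → ℚ) → Set
  SumsAgree f = sum (f ∘ A) ≡ sum (f ∘ B)

  SumsAgree-cong : ∀ {f g} → (∀ x → f x ≡ g x) → SumsAgree f → SumsAgree g
  SumsAgree-cong f≗g f-agrees =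
    trans (sum-cong-≗ (sym ∘ f≗g ∘ A)) (trans f-agrees (sum-cong-≗ (f≗g ∘ B)))

  SumsAgree-affine : ∀ a {f g} → SumsAgree f → SumsAgree g → SumsAgree (λ x → a · f x + g x)
  SumsAgree-affine a {f} {g} f-agrees g-agrees = begin
    sum (λ j → a · f (A j) + g (A j)) ≡⟨ split A ⟩
    a · sum (f ∘ A) + sum (g ∘ A)     ≡⟨ cong₂ (λ u v → a · u + v) f-agrees g-agrees ⟩
    a · sum (f ∘ B) + sum (g ∘ B)     ≡⟨ split B ⟨
    sum (λ j → a · f (B j) + g (B j)) ∎
    where
    split : ∀ X → sum (λ j → a · f (X j) + g (X j)) ≡ a · sum (f ∘ X) + sum (g ∘ X)
    split X = trans (∑-distrib-+ (λ j → a · f (X j)) (g ∘ X))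
                    (cong (_+ sum (g ∘ X)) (sym (*-distribˡ-sum a (f ∘ X))))

  module _ {m : ℕ} (pte : IsPTE m n A B) where

    monomial-sums-agree : ∀ k → totalDeg k ≤ m → SumsAgree (monomial k)
    monomial-sums-agree k |k|≤m with 1 ≤? totalDeg k
    ... | yes 1≤|k| = begin
      sum (monomial k ∘ A) ≡⟨ Σℚ≡sum (monomial k ∘ A) ⟨
      Σℚ (monomial k ∘ A)  ≡⟨ proj₂ pte k 1≤|k| |k|≤m ⟩
      Σℚ (monomial k ∘ B)  ≡⟨ Σℚ≡sum (monomial k ∘ B) ⟩
      sum (monomial k ∘ B) ∎
    ... | no  1≰|k| = SumsAgree-cong (λ x → sym (monomial-degree0 k |k|≡0 x)) refl
      where
      |k|≡0 : totalDeg k ≡ 0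
      |k|≡0 = n<1⇒n≡0 (≰⇒> 1≰|k|)

    poly-sums-agree : (p : Poly r m) → SumsAgree (eval p)
    poly-sums-agree (mkPoly []             [])            = refl
    poly-sums-agree (mkPoly ((a , k) ∷ ps) (|k|≤m ∷ ps≤m)) =
      SumsAgree-affine a {monomial k} {evalTerms ps}
        (monomial-sums-agree k |k|≤m) (poly-sums-agree (mkPoly ps ps≤m))

vanishes-on-A⇒vanishes-on-B : ∀ {r t n} {A B : Fin n → Pt r} → IsPTE (2 * t) n A B →
                              (p : Poly r t) → (∀ j → eval p (A j) ≡ 0ℚ) →
                              ∀ j → eval p (B j) ≡ 0ℚ
vanishes-on-A⇒vanishes-on-B {t = t} {A = A} {B} pte p p[A]≡0 =
  sum-squares≡0⇒≡0 (eval p ∘ B) (begin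
    sum (λ j → eval p (B j) · eval p (B j)) ≡⟨ squares-agree ⟨
    sum (λ j → eval p (A j) · eval p (A j)) ≡⟨ sum-zero _ square[A]≡0 ⟩
    0ℚ                                      ∎)
  where
  t+t≤2*t : t ℕ.+ t ≤ 2 * t
  t+t≤2*t = ≤-reflexive (cong (t ℕ.+_) (sym (+-identityʳ t)))
  squares-agree : SumsAgree A B (λ x → eval p x · eval p x)
  squares-agree =
    SumsAgree-cong A B (eval-*ᴾ p p) (poly-sums-agree A B pte (weaken t+t≤2*t (p *ᴾ p)))
  square[A]≡0 : ∀ j → eval p (A j) · eval p (A j) ≡ 0ℚ
  square[A]≡0 j = trans (cong (_· eval p (A j)) (p[A]≡0 j)) (ℚ.*-zeroˡ (eval p (A j)))

theorem2p12 : (r t n d : ℕ) → 1 ≤ t → (Ω : Pt r → Set)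
    → (A B : Fin n → Pt r) → (∀ j → Ω (A j)) → (∀ j → Ω (B j))
    → IsProperPTE (2 * t) n A B
    → (T : Fin d → Poly r t) → IsBasisPt t Ω d T
    → RowsIndependent2 T A B
    → d ≤ n
theorem2p12 r t n d _ _ A B _ _ (pte , _) T _ independent with d ≤? n
... | yes d≤n = d≤n
... | no  d≰n with n<d⇒nonTrivialSolution (≰⇒> d≰n) (λ j i → eval (T i) (A j))
...   | c , c≢0 , c⊥ = contradiction (independent c (as-Σℚ A F[A]≡0) (as-Σℚ B F[B]≡0)) c≢0
  where
  F : Poly r t
  F = lincomb c T
  F[A]≡0 : ∀ j → eval F (A j) ≡ 0ℚ
  F[A]≡0 j = trans (eval-lincomb c T (A j)) (c⊥ j)
  F[B]≡0 : ∀ j → eval F (B j) ≡ 0ℚ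
  F[B]≡0 = vanishes-on-A⇒vanishes-on-B pte F F[A]≡0
  as-Σℚ : ∀ X → (∀ j → eval F (X j) ≡ 0ℚ) → ∀ j → Σℚ (λ i → c i · eval (T i) (X j)) ≡ 0ℚ
  as-Σℚ X F[X]≡0 j =
    trans (Σℚ≡sum (λ i → c i · eval (T i) (X j))) (trans (sym (eval-lincomb c T (X j))) (F[X]≡0 j))
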